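{- Let $q\equiv 5\pmod 8$ be a prime power. Then every connected component of the aquarium $A(\mathbb{F}_q)$ is an isolated point, a fish, or a jellyfish.
   Context: $V(\mathbb{F}_q)=\{(a,b)\in\mathbb{F}_q^2: a\neq 0,\ b\neq 0,\ a\neq \pm b\}$. For $(a,b)\in V(\mathbb{F}_q)$: if $ab$ is a square in $\mathbb{F}_q^\times$, $\mathrm{AGM}(a,b)=\{(\tfrac{a+b}{2},s),(\tfrac{a+b}{2},-s)\}$ with $s^2=ab$; otherwise $\mathrm{AGM}(a,b)=\varnothing$. The aquarium $A(\mathbb{F}_q)$ is the directed graph on $V(\mathbb{F}_q)$ with an edge $(a,b)\to(a',b')$ iff $(a',b')\in\mathrm{AGM}(a,b)$. Connected components are those of the underlying undirected graph. An isolated point is a component with no edges. A fish is a connected component with exactly 4 vertices. A strongly connected component is nontrivial if it has more than one vertex; a jellyfish is a connected component which is not strongly connected but contains a nontrivial strongly connected component. -}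

module Defs where

open import Level using (Level; _⊔_)
open import Data.Nat using (ℕ; suc; _^_)
open import Data.Nat.Primality using (Prime)
open import Data.Fin using (Fin)
open import Data.Product using (Σ; ∃; _×_; _,_; proj₁; proj₂)
open import Data.Sum using (_⊎_)
open import Relation.Nullary using (¬_)
open import Relation.Binary.PropositionalEquality as ≡ using (_≡_)
open import Relation.Binary.Construct.Closure.ReflexiveTransitive using (Star)
open import Function.Bundles using (Inverse)
open import Algebra.Bundles using (CommutativeRing)

IsPrimePower : ℕ → Set
IsPrimePower q = Σ ℕ λ p → Σ ℕ λ k → Prime p × q ≡ p ^ suc k

record FiniteField (c ℓ : Level) (q : ℕ) : Set (Level.suc (c ⊔ ℓ)) where
  field
    commRing : CommutativeRing c ℓ
  open CommutativeRing commRing public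
  field
    1≉0     : ¬ (1# ≈ 0#)
    inverse : ∀ x → ¬ (x ≈ 0#) → Σ Carrier λ y → x * y ≈ 1#
    card    : Inverse (≡.setoid (Fin q)) setoid

module Aquarium {c ℓ : Level} {q : ℕ} (F : FiniteField c ℓ q) where
  open FiniteField F

  record Vertex : Set (c ⊔ ℓ) where
    constructor vtx
    field
      a b  : Carrier
      a≉0  : ¬ (a ≈ 0#)
      b≉0  : ¬ (b ≈ 0#)
      a≉b  : ¬ (a ≈ b)
      a≉-b : ¬ (a ≈ - b)
  open Vertex public

  _≋_ : Vertex → Vertex → Set ℓ
  v ≋ w = (a v ≈ a w) × (b v ≈ b w)

  IsSquare : Carrier → Set (c ⊔ ℓ)
  IsSquare x = Σ Carrier λ s → s * s ≈ x

  two : Carrier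
  two = 1# + 1#

  -- (a',b') ∈ AGM(a,b): ab is a square, a' = (a+b)/2 (i.e. 2a' = a+b),
  -- and b' = ±s where s² = ab (i.e. b'² = ab).
  Edge : Vertex → Vertex → Set (c ⊔ ℓ)
  Edge v w = IsSquare (a v * b v)
           × (two * a w ≈ a v + b v)
           × (b w * b w ≈ a v * b v)

  UEdge : Vertex → Vertex → Set (c ⊔ ℓ)
  UEdge v w = Edge v w ⊎ Edge w v

  Connected : Vertex → Vertex → Set (c ⊔ ℓ)
  Connected = Star UEdge

  Reach : Vertex → Vertex → Set (c ⊔ ℓ)
  Reach = Star Edge

  -- The connected component of v is the set of w with Connected v w.

  IsIsolatedComponent : Vertex → Set (c ⊔ ℓ)
  IsIsolatedComponent v =
    ∀ w u → Connected v w → Connected v u → ¬ Edge w u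

  IsFishComponent : Vertex → Set (c ⊔ ℓ)
  IsFishComponent v =
    Σ Vertex λ w₁ → Σ Vertex λ w₂ → Σ Vertex λ w₃ → Σ Vertex λ w₄ →
      (Connected v w₁ × Connected v w₂ × Connected v w₃ × Connected v w₄)
    × (¬ (w₁ ≋ w₂) × ¬ (w₁ ≋ w₃) × ¬ (w₁ ≋ w₄)
       × ¬ (w₂ ≋ w₃) × ¬ (w₂ ≋ w₄) × ¬ (w₃ ≋ w₄))
    × (∀ u → Connected v u → (u ≋ w₁) ⊎ (u ≋ w₂) ⊎ (u ≋ w₃) ⊎ (u ≋ w₄))

  IsStronglyConnectedComponent : Vertex → Set (c ⊔ ℓ)
  IsStronglyConnectedComponent v =
    ∀ w u → Connected v w → Connected v u → Reach w u

  HasNontrivialSCC : Vertex → Set (c ⊔ ℓ)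
  HasNontrivialSCC v =
    Σ Vertex λ w → Σ Vertex λ u →
      Connected v w × Connected v u × ¬ (w ≋ u) × Reach w u × Reach u w

  IsJellyfishComponent : Vertex → Set (c ⊔ ℓ)
  IsJellyfishComponent v =
    ¬ IsStronglyConnectedComponent v × HasNontrivialSCC v

-- For q ≡ 5 (mod 8), counting arguments in F_q show that −1 has a square root ι, that ι is not a
-- square, and that the product of two nonsquares is a square.  A vertex (a , b) has successors iff ab
-- is a square, namely (½(a + b) , ±t) with t² = ab, and predecessors iff a² − b² is a square.  If w has
-- both, then the coordinate products of its successors and of those, (½(a − b) , ±ιt), of its sibling
-- (a , −b) multiply to ι times a nonzero square, so exactly one of the two pairs has successors.
-- Following the good pair one can walk forever, which in a finite graph closes a cycle, while the other
-- pair consists of sinks: the component is a jellyfish.  If no vertex has both, a component with an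
-- edge is {p , swap p , c , −c} for a source p and a sink c, a fish; a vertex without edges is isolated.
module Submission where

open import Defs
open import Level using (Level)
open import Data.Nat using (ℕ; _%_)
open import Data.Sum using (_⊎_)
open import Relation.Binary.PropositionalEquality using (_≡_)

open import Level using (_⊔_)
open import Algebra.Bundles using (CommutativeRing)
import Algebra.Solver.Ring
open import Algebra.Solver.Ring.AlmostCommutativeRing using (fromCommutativeRing; _-Raw-AlmostCommutative⟶_)
open import Data.Empty using (⊥)
open import Data.Fin as Fin using (Fin; zero; suc)
import Data.Fin.Properties as Fin
import Data.Integer as ℤ
import Data.Integer.Properties as ℤ
open import Data.Maybe using (Maybe; just; nothing)
open import Data.Nat as ℕ using (zero; suc; _/_)
import Data.Nat.Properties as ℕ
open import Data.Nat.DivMod using (m≡m%n+[m/n]*n)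
open import Data.Nat.Divisibility
  using (_∣_; divides; _∣0; ∣-refl; ∣1⇒≡1; ∣m∣n⇒∣m+n; ∣m+n∣m⇒∣n)
open import Data.Nat.Tactic.RingSolver using (solve-∀)
open import Data.Product using (Σ; ∃; ∃₂; _×_; _,_; proj₁; proj₂)
open import Data.Sign as Sign using (Sign)
open import Data.Sum as Sum using (inj₁; inj₂; [_,_])
open import Function using (_∘_; _$_)
open import Function.Bundles using (Inverse)
open import Relation.Binary.Bundles using (Setoid)
import Relation.Binary.Definitions as B
open import Relation.Binary.Definitions using (_Respects_)
open import Relation.Binary.Construct.Closure.ReflexiveTransitive using (Star; ε; _◅_; _◅◅_; reverse)
import Relation.Binary.PropositionalEquality as ≡
open import Relation.Nullary using (¬_; ¬?; Dec; yes; no; map′; contradiction; _×-dec_)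
open import Relation.Unary using (Pred; Decidable; Empty; Universal; U; _∖_; _≐_)
open import Relation.Unary.Properties using (U?; _∩?_; ∁?)

module IntegerCoefficientSolver {c ℓ : Level} (R : CommutativeRing c ℓ) where
  open import Data.Integer using (ℤ; +_; -[1+_]; _⊖_; sign; ∣_∣; _◃_)
  open CommutativeRing R
  open import Algebra.Properties.Semiring.Mult.TCOptimised semiring
    using (×-homo-+; ×1-homo-*; 1+×) renaming (_×_ to _×′_)
  open import Algebra.Properties.Ring ring using (-1*x≈-x; -‿involutive; -0#≈0#; -‿+-comm)
  open import Algebra.Properties.CommutativeSemigroup *-commutativeSemigroup using (interchange)
  open import Relation.Binary.Reasoning.Setoid setoid

  fromℤ : ℤ → Carrier
  fromℤ (+ n)      = n ×′ 1#
  fromℤ -[1+ n ]   = - (suc n ×′ 1#)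

  fromℤ-homo-neg : ∀ i → fromℤ (ℤ.- i) ≈ - fromℤ i
  fromℤ-homo-neg -[1+ n ]  = sym (-‿involutive _)
  fromℤ-homo-neg (+ zero)  = sym -0#≈0#
  fromℤ-homo-neg (+ suc n) = refl

  1+x-[1+y]≈x-y : ∀ x y → (1# + x) - (1# + y) ≈ x - y
  1+x-[1+y]≈x-y x y = begin
    (1# + x) - (1# + y)       ≈⟨ +-congˡ (-‿+-comm 1# y) ⟨
    (1# + x) + (- 1# - y)     ≈⟨ +-assoc 1# x _ ⟩
    1# + (x + (- 1# - y))     ≈⟨ +-congˡ (+-assoc x (- 1#) _) ⟨
    1# + ((x - 1#) - y)       ≈⟨ +-congˡ (+-congʳ (+-comm x (- 1#))) ⟩
    1# + ((- 1# + x) - y)     ≈⟨ +-congˡ (+-assoc (- 1#) x _) ⟩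
    1# + (- 1# + (x - y))     ≈⟨ +-assoc 1# (- 1#) _ ⟨
    (1# - 1#) + (x - y)       ≈⟨ +-congʳ (-‿inverseʳ 1#) ⟩
    0# + (x - y)              ≈⟨ +-identityˡ _ ⟩
    x - y                     ∎

  fromℤ-homo-⊖ : ∀ m n → fromℤ (m ⊖ n) ≈ m ×′ 1# - n ×′ 1#
  fromℤ-homo-⊖ m       zero    = sym (trans (+-congˡ -0#≈0#) (+-identityʳ _))
  fromℤ-homo-⊖ zero    (suc n) = sym (+-identityˡ _)
  fromℤ-homo-⊖ (suc m) (suc n) = begin
    fromℤ (suc m ⊖ suc n)              ≡⟨ ≡.cong fromℤ (ℤ.[1+m]⊖[1+n]≡m⊖n m n) ⟩
    fromℤ (m ⊖ n)                      ≈⟨ fromℤ-homo-⊖ m n ⟩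
    m ×′ 1# - n ×′ 1#                  ≈⟨ 1+x-[1+y]≈x-y _ _ ⟨
    (1# + m ×′ 1#) - (1# + n ×′ 1#)    ≈⟨ +-cong (1+× m 1#) (-‿cong (1+× n 1#)) ⟨
    suc m ×′ 1# - suc n ×′ 1#          ∎

  fromℤ-homo-+ : ∀ i j → fromℤ (i ℤ.+ j) ≈ fromℤ i + fromℤ j
  fromℤ-homo-+ -[1+ m ] -[1+ n ] = begin
    - (suc (suc (m ℕ.+ n)) ×′ 1#)      ≡⟨ ≡.cong (λ k → - (k ×′ 1#)) (ℕ.+-suc (suc m) n) ⟨
    - ((suc m ℕ.+ suc n) ×′ 1#)        ≈⟨ -‿cong (×-homo-+ 1# (suc m) (suc n)) ⟩
    - (suc m ×′ 1# + suc n ×′ 1#)      ≈⟨ -‿+-comm _ _ ⟨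
    - (suc m ×′ 1#) - suc n ×′ 1#      ∎
  fromℤ-homo-+ -[1+ m ] (+ n)    = trans (fromℤ-homo-⊖ n (suc m)) (+-comm _ _)
  fromℤ-homo-+ (+ m)    -[1+ n ] = fromℤ-homo-⊖ m (suc n)
  fromℤ-homo-+ (+ m)    (+ n)    = ×-homo-+ 1# m n

  fromSign : Sign → Carrier
  fromSign Sign.+ = 1#
  fromSign Sign.- = - 1#

  fromSign-homo-* : ∀ s t → fromSign (s Sign.* t) ≈ fromSign s * fromSign t
  fromSign-homo-* Sign.+ _      = sym (*-identityˡ _)
  fromSign-homo-* Sign.- Sign.+ = sym (*-identityʳ _)
  fromSign-homo-* Sign.- Sign.- = sym (trans (-1*x≈-x (- 1#)) (-‿involutive 1#))

  fromℤ-homo-◃ : ∀ s n → fromℤ (s ◃ n) ≈ fromSign s * (n ×′ 1#)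
  fromℤ-homo-◃ _      zero    = sym (zeroʳ _)
  fromℤ-homo-◃ Sign.+ (suc n) = sym (*-identityˡ _)
  fromℤ-homo-◃ Sign.- (suc n) = sym (-1*x≈-x _)

  fromℤ≈sign*abs : ∀ i → fromℤ i ≈ fromSign (sign i) * (∣ i ∣ ×′ 1#)
  fromℤ≈sign*abs (+ n)    = sym (*-identityˡ _)
  fromℤ≈sign*abs -[1+ n ] = sym (-1*x≈-x _)

  fromℤ-homo-* : ∀ i j → fromℤ (i ℤ.* j) ≈ fromℤ i * fromℤ j
  fromℤ-homo-* i j = begin
    fromℤ ((sign i Sign.* sign j) ◃ (∣ i ∣ ℕ.* ∣ j ∣))
      ≈⟨ fromℤ-homo-◃ (sign i Sign.* sign j) (∣ i ∣ ℕ.* ∣ j ∣) ⟩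
    fromSign (sign i Sign.* sign j) * ((∣ i ∣ ℕ.* ∣ j ∣) ×′ 1#)
      ≈⟨ *-cong (fromSign-homo-* (sign i) (sign j)) (×1-homo-* ∣ i ∣ ∣ j ∣) ⟩
    (fromSign (sign i) * fromSign (sign j)) * ((∣ i ∣ ×′ 1#) * (∣ j ∣ ×′ 1#))
      ≈⟨ interchange _ _ _ _ ⟩
    (fromSign (sign i) * (∣ i ∣ ×′ 1#)) * (fromSign (sign j) * (∣ j ∣ ×′ 1#))
      ≈⟨ *-cong (fromℤ≈sign*abs i) (fromℤ≈sign*abs j) ⟨
    fromℤ i * fromℤ j
      ∎

  fromℤ-homomorphism : ℤ.+-*-rawRing -Raw-AlmostCommutative⟶ fromCommutativeRing R
  fromℤ-homomorphism = record
    { ⟦_⟧    = fromℤ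
    ; +-homo = fromℤ-homo-+
    ; *-homo = fromℤ-homo-*
    ; -‿homo = fromℤ-homo-neg
    ; 0-homo = refl
    ; 1-homo = refl
    }

  fromℤ-≈-weaklyDec : ∀ i j → Maybe (fromℤ i ≈ fromℤ j)
  fromℤ-≈-weaklyDec i j with i ℤ.≟ j
  ... | yes ≡.refl = just refl
  ... | no _       = nothing

  open Algebra.Solver.Ring ℤ.+-*-rawRing (fromCommutativeRing R) fromℤ-homomorphism fromℤ-≈-weaklyDec public
    using (solve; _:=_; _:+_; _:*_; _:-_; :-_; con)

private
  variable
    ℓ₀ ℓ₁ ℓ₂ : Level

_∖?_ : {A : Set ℓ₀} {P : Pred A ℓ₁} {Q : Pred A ℓ₂} →
       Decidable P → Decidable Q → Decidable (P ∖ Q)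
P? ∖? Q? = P? ∩? ∁? Q?

module FinCount where
  open import Data.Nat.Base using (_+_)

  count : ∀ {m} {P : Pred (Fin m) ℓ₁} → Decidable P → ℕ
  count {m = zero}  P? = 0
  count {m = suc m} P? with P? zero
  ... | yes _ = suc (count (P? ∘ suc))
  ... | no  _ = count (P? ∘ suc)

  count-cong : ∀ {m} {P : Pred (Fin m) ℓ₁} {Q : Pred (Fin m) ℓ₂} (P? : Decidable P) (Q? : Decidable Q) →
               P ≐ Q → count P? ≡ count Q?
  count-cong {m = zero}  P? Q? _ = ≡.refl
  count-cong {m = suc m} P? Q? (P⊆Q , Q⊆P) with P? zero | Q? zero
  ... | yes _  | yes _  = ≡.cong suc (count-cong (P? ∘ suc) (Q? ∘ suc) (P⊆Q , Q⊆P))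
  ... | yes Pz | no ¬Qz = contradiction (P⊆Q Pz) ¬Qz
  ... | no ¬Pz | yes Qz = contradiction (Q⊆P Qz) ¬Pz
  ... | no _   | no _   = count-cong (P? ∘ suc) (Q? ∘ suc) (P⊆Q , Q⊆P)

  count-∅ : ∀ {m} {P : Pred (Fin m) ℓ₁} (P? : Decidable P) → Empty P → count P? ≡ 0
  count-∅ {m = zero}  P? ∅ = ≡.refl
  count-∅ {m = suc m} P? ∅ with P? zero
  ... | yes Pz = contradiction Pz (∅ zero)
  ... | no _   = count-∅ (P? ∘ suc) (∅ ∘ suc)

  count-U : ∀ {m} {P : Pred (Fin m) ℓ₁} (P? : Decidable P) → Universal P → count P? ≡ m
  count-U {m = zero}  P? U = ≡.refl
  count-U {m = suc m} P? U with P? zero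
  ... | yes _  = ≡.cong suc (count-U (P? ∘ suc) (U ∘ suc))
  ... | no ¬Pz = contradiction (U zero) ¬Pz

  count-split : ∀ {m} {P : Pred (Fin m) ℓ₁} {Q : Pred (Fin m) ℓ₂} (P? : Decidable P) (Q? : Decidable Q) →
                count P? ≡ count (P? ∩? Q?) + count (P? ∖? Q?)
  count-split {m = zero}  P? Q? = ≡.refl
  count-split {m = suc m} P? Q? with P? zero | Q? zero
  ... | yes _ | yes _ = ≡.cong suc (count-split (P? ∘ suc) (Q? ∘ suc))
  ... | yes _ | no _  = ≡.trans (≡.cong suc (count-split (P? ∘ suc) (Q? ∘ suc))) (≡.sym (ℕ.+-suc _ _))
  ... | no _  | _     = count-split (P? ∘ suc) (Q? ∘ suc)

  count-singleton : ∀ {m} (j : Fin m) → count (Fin._≟ j) ≡ 1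
  count-singleton {m = suc m} zero =
    ≡.cong suc (count-∅ {m = m} ((Fin._≟ zero) ∘ suc) (λ _ ()))
  count-singleton {m = suc m} (suc j) = ≡.trans
    (count-cong ((Fin._≟ suc j) ∘ suc) (Fin._≟ j) (Fin.suc-injective , ≡.cong suc))
    (count-singleton j)

module FiniteSetoid {c ℓ} {n : ℕ} (S : Setoid c ℓ) (card : Inverse (≡.setoid (Fin n)) S) where
  open import Data.Nat.Base using (_+_; _≤_; z≤n; s≤s)
  open Setoid S
  open Inverse card using (to; from; from-cong; strictlyInverseˡ; strictlyInverseʳ)
  open FinCount

  from-injective : ∀ {x y} → from x ≡ from y → x ≈ y
  from-injective {x} {y} eq =
    trans (sym (strictlyInverseˡ x)) (trans (reflexive (≡.cong to eq)) (strictlyInverseˡ y))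

  infix 4 _≟_
  _≟_ : B.Decidable _≈_
  x ≟ y = map′ from-injective from-cong (from x Fin.≟ from y)

  pigeonhole² : (u v : ℕ → Carrier) → ∃₂ λ i j → i ℕ.< j × u i ≈ u j × v i ≈ v j
  pigeonhole² u v
    with Fin.pigeonhole (ℕ.n<1+n (n ℕ.* n)) (λ k → Fin.combine (from (u (Fin.toℕ k))) (from (v (Fin.toℕ k))))
  ... | i , j , i<j , same = let (uᵢ≡uⱼ , vᵢ≡vⱼ) = Fin.combine-injective _ _ _ _ same in
    Fin.toℕ i , Fin.toℕ j , i<j , from-injective uᵢ≡uⱼ , from-injective vᵢ≡vⱼ

  ∃? : {P : Pred Carrier ℓ₁} → P Respects _≈_ → Decidable P → Dec (∃ P)
  ∃? resp P? = map′ (λ (i , Pi) → to i , Pi) (λ (x , Px) → from x , resp (sym (strictlyInverseˡ x)) Px)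
                    (Fin.any? (P? ∘ to))

  #_ : {P : Pred Carrier ℓ₁} → Decidable P → ℕ
  # P? = count (P? ∘ to)

  _─_ : Pred Carrier ℓ₁ → Carrier → Pred Carrier (ℓ₁ ⊔ ℓ)
  P ─ x = P ∖ (_≈ x)

  _─?_ : {P : Pred Carrier ℓ₁} → Decidable P → (x : Carrier) → Decidable (P ─ x)
  P? ─? x = P? ∖? (_≟ x)

  ─-respects : {P : Pred Carrier ℓ₁} {x : Carrier} → P Respects _≈_ → (P ─ x) Respects _≈_
  ─-respects resp y≈z (Py , y≉x) = resp y≈z Py , λ z≈x → y≉x (trans y≈z z≈x)

  #-U : {P : Pred Carrier ℓ₁} (P? : Decidable P) → Universal P → # P? ≡ n
  #-U P? U = count-U (P? ∘ to) (U ∘ to)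

  #≡suc⇒∃ : {P : Pred Carrier ℓ₁} (P? : Decidable P) → ∀ {k} → # P? ≡ suc k → ∃ P
  #≡suc⇒∃ P? #P≡1+k with Fin.any? (P? ∘ to)
  ... | yes (i , Pi) = to i , Pi
  ... | no ∄P = contradiction (≡.trans (≡.sym #P≡1+k) (count-∅ (P? ∘ to) (λ i Pi → ∄P (i , Pi)))) λ ()

  #-cong : {P : Pred Carrier ℓ₁} {Q : Pred Carrier ℓ₂} (P? : Decidable P) (Q? : Decidable Q) →
           P ≐ Q → # P? ≡ # Q?
  #-cong P? Q? (P⊆Q , Q⊆P) = count-cong (P? ∘ to) (Q? ∘ to) (P⊆Q , Q⊆P)

  #-split : {P : Pred Carrier ℓ₁} {Q : Pred Carrier ℓ₂} (P? : Decidable P) (Q? : Decidable Q) →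
            # P? ≡ # (P? ∩? Q?) + # (P? ∖? Q?)
  #-split P? Q? = count-split (P? ∘ to) (Q? ∘ to)

  #-singleton : ∀ x → # (_≟ x) ≡ 1
  #-singleton x = ≡.trans
    (count-cong ((_≟ x) ∘ to) (Fin._≟ from x)
      ( (λ toi≈x → ≡.trans (≡.sym (strictlyInverseʳ _)) (from-cong toi≈x))
      , (λ { ≡.refl → strictlyInverseˡ x })))
    (count-singleton (from x))

  #-remove : {P : Pred Carrier ℓ₁} (P? : Decidable P) → P Respects _≈_ →
             ∀ {x} → P x → # P? ≡ suc (# (P? ─? x))
  #-remove {P = P} P? resp {x} Px = begin
    # P?                             ≡⟨ #-split P? (_≟ x) ⟩
    # (P? ∩? (_≟ x)) + # (P? ─? x)   ≡⟨ ≡.cong (_+ # (P? ─? x)) #P∩x≡#x ⟩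
    # (_≟ x) + # (P? ─? x)           ≡⟨ ≡.cong (_+ # (P? ─? x)) (#-singleton x) ⟩
    suc (# (P? ─? x))                ∎
    where
    open ≡.≡-Reasoning
    #P∩x≡#x : # (P? ∩? (_≟ x)) ≡ # (_≟ x)
    #P∩x≡#x = #-cong (P? ∩? (_≟ x)) (_≟ x) ((λ (_ , y≈x) → y≈x) , λ y≈x → resp (sym y≈x) Px , y≈x)

  record IsFreeInvolutionOn (P : Pred Carrier ℓ₁) (σ : Carrier → Carrier) : Set (c ⊔ ℓ ⊔ ℓ₁) where
    field
      σ-cong        : ∀ {x y} → x ≈ y → σ x ≈ σ y
      closed        : ∀ {x} → P x → P (σ x)
      involutive    : ∀ {x} → P x → σ (σ x) ≈ x
      fixpoint-free : ∀ {x} → P x → ¬ σ x ≈ x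

    σ-injective : ∀ {x y} → P x → P y → σ x ≈ σ y → x ≈ y
    σ-injective Px Py σx≈σy = trans (sym (involutive Px)) (trans (σ-cong σx≈σy) (involutive Py))

    removeOrbit : ∀ {x} → P x → IsFreeInvolutionOn ((P ─ x) ─ σ x) σ
    removeOrbit {x} Px = record
      { σ-cong        = σ-cong
      ; closed        = λ ((Py , y≉x) , y≉σx) →
          (closed Py , λ σy≈x → y≉σx (trans (sym (involutive Py)) (σ-cong σy≈x)))
          , λ σy≈σx → y≉x (σ-injective Py Px σy≈σx)
      ; involutive    = λ ((Py , _) , _) → involutive Py
      ; fixpoint-free = λ ((Py , _) , _) → fixpoint-free Py
      }

    #-removeOrbit : (P? : Decidable P) → P Respects _≈_ →
                    ∀ {x} → P x → # P? ≡ 2 + # ((P? ─? x) ─? σ x)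
    #-removeOrbit P? resp {x} Px = ≡.trans (#-remove P? resp Px)
      (≡.cong suc (#-remove (P? ─? x) (─-respects resp) (closed Px , fixpoint-free Px)))

  #-even : {P : Pred Carrier ℓ₁} {σ : Carrier → Carrier} (P? : Decidable P) → P Respects _≈_ →
           IsFreeInvolutionOn P σ → 2 ∣ # P?
  #-even P? resp inv = go (# P?) P? resp inv ≡.refl
    where
    go : ∀ {P : Pred Carrier ℓ₁} {σ} k (P? : Decidable P) → P Respects _≈_ →
         IsFreeInvolutionOn P σ → # P? ≡ k → 2 ∣ k
    go zero _ _ _ _ = 2 ∣0
    go (suc k) P? resp inv #P≡1+k with #≡suc⇒∃ P? #P≡1+k
    ... | x , Px with k | ≡.trans (≡.sym #P≡1+k) (IsFreeInvolutionOn.#-removeOrbit inv P? resp Px)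
    ...   | suc k′ | ≡.refl = ∣m∣n⇒∣m+n ∣-refl
              (go k′ ((P? ─? x) ─? _) (─-respects (─-respects resp))
                  (IsFreeInvolutionOn.removeOrbit inv Px) ≡.refl)

  record IsTwoToOne (P : Pred Carrier ℓ₁) (Q : Pred Carrier ℓ₂) (f σ : Carrier → Carrier) :
                    Set (c ⊔ ℓ ⊔ ℓ₁ ⊔ ℓ₂) where
    field
      f-cong  : ∀ {x y} → x ≈ y → f x ≈ f y
      orbits  : IsFreeInvolutionOn P σ
      into    : ∀ {x} → P x → Q (f x)
      onto    : ∀ {y} → Q y → ∃ λ x → P x × f x ≈ y
      f∘σ≈f   : ∀ {x} → P x → f (σ x) ≈ f x
      fibres  : ∀ {x z} → P x → P z → f z ≈ f x → z ≈ x ⊎ z ≈ σ x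

    open IsFreeInvolutionOn orbits

    removeFibre : ∀ {x} → P x → IsTwoToOne ((P ─ x) ─ σ x) (Q ─ f x) f σ
    removeFibre {x} Px = record
      { f-cong = f-cong
      ; orbits = removeOrbit Px
      ; into   = λ ((Pz , z≉x) , z≉σx) →
          into Pz , λ fz≈fx → [ z≉x , z≉σx ] (fibres Px Pz fz≈fx)
      ; onto   = λ (Qy , y≉fx) → let (z , Pz , fz≈y) = onto Qy in
          z , ((Pz , λ z≈x → y≉fx (trans (sym fz≈y) (f-cong z≈x)))
              , λ z≈σx → y≉fx (trans (sym fz≈y) (trans (f-cong z≈σx) (f∘σ≈f Px))))
            , fz≈y
      ; f∘σ≈f  = λ ((Pz , _) , _) → f∘σ≈f Pz
      ; fibres = λ ((Pz , _) , _) ((Pz′ , _) , _) → fibres Pz Pz′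
      }

  #-twoToOne : {P : Pred Carrier ℓ₁} {Q : Pred Carrier ℓ₂} {f σ : Carrier → Carrier}
               (P? : Decidable P) (Q? : Decidable Q) → P Respects _≈_ → Q Respects _≈_ →
               IsTwoToOne P Q f σ → # P? ≡ # Q? + # Q?
  #-twoToOne P? Q? respP respQ 2:1 = go (# Q?) P? Q? respP respQ 2:1 ≡.refl
    where
    go : ∀ {P : Pred Carrier ℓ₁} {Q : Pred Carrier ℓ₂} {f σ} k (P? : Decidable P) (Q? : Decidable Q) →
         P Respects _≈_ → Q Respects _≈_ → IsTwoToOne P Q f σ → # Q? ≡ k → # P? ≡ k + k
    go zero P? Q? respP respQ 2:1 #Q≡0 with # P? in #P≡
    ... | zero  = ≡.refl
    ... | suc _ = let (x , Px) = #≡suc⇒∃ P? #P≡ in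
      contradiction (≡.trans (≡.sym #Q≡0) (#-remove Q? respQ (IsTwoToOne.into 2:1 Px))) λ ()
    go {f = f} {σ = σ} (suc k) P? Q? respP respQ 2:1 #Q≡1+k = begin
      # P?                        ≡⟨ IsFreeInvolutionOn.#-removeOrbit orbits P? respP Px ⟩
      2 + # ((P? ─? x) ─? σ x)    ≡⟨ ≡.cong (2 +_) (go k ((P? ─? x) ─? σ x) (Q? ─? f x)
                                       (─-respects (─-respects respP)) (─-respects respQ)
                                       (removeFibre Px) #Q′≡k) ⟩
      2 + (k + k)                 ≡⟨ ≡.cong suc (ℕ.+-suc k k) ⟨
      suc k + suc k               ∎
      where
      open ≡.≡-Reasoning
      open IsTwoToOne 2:1
      x  = proj₁ (onto (proj₂ (#≡suc⇒∃ Q? #Q≡1+k)))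
      Px = proj₁ (proj₂ (onto (proj₂ (#≡suc⇒∃ Q? #Q≡1+k))))
      #Q′≡k : # (Q? ─? f x) ≡ k
      #Q′≡k = ℕ.suc-injective (≡.trans (≡.sym (#-remove Q? respQ (into Px))) #Q≡1+k)

  record IsInjectionInto (P : Pred Carrier ℓ₁) (Q : Pred Carrier ℓ₂) (f : Carrier → Carrier) :
                         Set (c ⊔ ℓ ⊔ ℓ₁ ⊔ ℓ₂) where
    field
      f-cong    : ∀ {x y} → x ≈ y → f x ≈ f y
      into      : ∀ {x} → P x → Q (f x)
      injective : ∀ {x z} → P x → P z → f x ≈ f z → x ≈ z

    removePoint : ∀ {x} → P x → IsInjectionInto (P ─ x) (Q ─ f x) f
    removePoint Px = record
      { f-cong    = f-cong
      ; into      = λ (Pz , z≉x) → into Pz , λ fz≈fx → z≉x (injective Pz Px fz≈fx)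
      ; injective = λ (Pz , _) (Pz′ , _) → injective Pz Pz′
      }

  #-injection-≤ : {P : Pred Carrier ℓ₁} {Q : Pred Carrier ℓ₂} {f : Carrier → Carrier}
                  (P? : Decidable P) (Q? : Decidable Q) → P Respects _≈_ → Q Respects _≈_ →
                  IsInjectionInto P Q f → # P? ≤ # Q?
  #-injection-≤ P? Q? respP respQ inj = go (# P?) P? Q? respP respQ inj ≡.refl
    where
    go : ∀ {P : Pred Carrier ℓ₁} {Q : Pred Carrier ℓ₂} {f} k (P? : Decidable P) (Q? : Decidable Q) →
         P Respects _≈_ → Q Respects _≈_ → IsInjectionInto P Q f → # P? ≡ k → k ≤ # Q?
    go zero _ _ _ _ _ _ = z≤n
    go {f = f} (suc k) P? Q? respP respQ inj #P≡1+k =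
      ≡.subst (suc k ≤_) (≡.sym (#-remove Q? respQ (into Px)))
        (s≤s (go k (P? ─? x) (Q? ─? f x) (─-respects respP) (─-respects respQ) (removePoint Px)
                 (ℕ.suc-injective (≡.trans (≡.sym (#-remove P? respP Px)) #P≡1+k))))
      where
      open IsInjectionInto inj
      x  = proj₁ (#≡suc⇒∃ P? #P≡1+k)
      Px = proj₂ (#≡suc⇒∃ P? #P≡1+k)

  #-injection-onto : {P : Pred Carrier ℓ₁} {Q : Pred Carrier ℓ₂} {f : Carrier → Carrier}
                     (P? : Decidable P) (Q? : Decidable Q) → P Respects _≈_ → Q Respects _≈_ →
                     IsInjectionInto P Q f → # P? ≡ # Q? →
                     ∀ {y} → Q y → ∃ λ x → P x × f x ≈ y
  #-injection-onto {P = P} {Q = Q} {f = f} P? Q? respP respQ inj #P≡#Q {y} Qy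
    with ∃? respFibre (λ x → P? x ×-dec (f x ≟ y))
    where
    open IsInjectionInto inj
    respFibre : (λ x → P x × f x ≈ y) Respects _≈_
    respFibre x≈z (Px , fx≈y) = respP x≈z Px , trans (sym (f-cong x≈z)) fx≈y
  ... | yes hit  = hit
  ... | no  miss = contradiction #P≡#Q (ℕ.<⇒≢ (≡.subst (# P? ℕ.<_) (≡.sym (#-remove Q? respQ Qy))
                      (s≤s (#-injection-≤ P? (Q? ─? y) respP (─-respects respQ) missing-y))))
    where
    open IsInjectionInto inj
    missing-y : IsInjectionInto P (Q ─ y) f
    missing-y = record
      { f-cong    = f-cong
      ; into      = λ {x} Px → into Px , λ fx≈y → miss (x , Px , fx≈y)
      ; injective = injective
      }

module Parity where
  open import Data.Nat.Base using (_+_; _*_)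

  2∣n+n : ∀ n → 2 ∣ n + n
  2∣n+n n = divides n (n+n≡n*2 n)
    where
    n+n≡n*2 : ∀ n → n + n ≡ n * 2
    n+n≡n*2 = solve-∀

  2∣n⇒2∤1+n : ∀ {n} → 2 ∣ n → ¬ (2 ∣ suc n)
  2∣n⇒2∤1+n {n} 2∣n 2∣1+n =
    contradiction (∣1⇒≡1 (∣m+n∣m⇒∣n (≡.subst (2 ∣_) (ℕ.+-comm 1 n) 2∣1+n) 2∣n)) λ ()

  +-halve : ∀ {m n} → m + m ≡ n + n → m ≡ n
  +-halve {m} {n} m+m≡n+n =
    ≡.trans (ℕ.n≡⌊n+n/2⌋ m) (≡.trans (≡.cong ℕ.⌊_/2⌋ m+m≡n+n) (≡.sym (ℕ.n≡⌊n+n/2⌋ n)))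

open Parity

module FiniteFieldProperties {c ℓ : Level} {q : ℕ} (F : FiniteField c ℓ q) where
  open import Data.Integer using (+_)
  open FiniteField F
  open Aquarium F using (IsSquare; two)
  open IntegerCoefficientSolver commRing using (solve; _:=_; _:+_; _:*_; _:-_; :-_; con)
  open FiniteSetoid setoid card public
  open import Algebra.Properties.Ring ring
    using (-‿involutive; -0#≈0#; -1*x≈-x; x∙y⁻¹≈ε⇒x≈y; +-inverseˡ-unique)
  open import Relation.Binary.Reasoning.Setoid setoid

  Nonzero : Pred Carrier ℓ
  Nonzero x = ¬ (x ≈ 0#)

  nonzero? : Decidable Nonzero
  nonzero? x = ¬? (x ≟ 0#)

  Nonzero-respects : Nonzero Respects _≈_
  Nonzero-respects x≈y x≉0 y≈0 = x≉0 (trans x≈y y≈0)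

  *-cancelˡ : ∀ {a x y} → Nonzero a → a * x ≈ a * y → x ≈ y
  *-cancelˡ {a} {x} {y} a≉0 ax≈ay = begin
    x              ≈⟨ *-identityˡ x ⟨
    1# * x         ≈⟨ *-congʳ (trans (*-comm a′ a) a*a′≈1) ⟨
    (a′ * a) * x   ≈⟨ *-assoc a′ a x ⟩
    a′ * (a * x)   ≈⟨ *-congˡ ax≈ay ⟩
    a′ * (a * y)   ≈⟨ *-assoc a′ a y ⟨
    (a′ * a) * y   ≈⟨ *-congʳ (trans (*-comm a′ a) a*a′≈1) ⟩
    1# * y         ≈⟨ *-identityˡ y ⟩
    y              ∎
    where
    a′ = proj₁ (inverse a a≉0)
    a*a′≈1 = proj₂ (inverse a a≉0)

  x*y≉0 : ∀ {x y} → Nonzero x → Nonzero y → Nonzero (x * y)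
  x*y≉0 {x} x≉0 y≉0 xy≈0 = y≉0 (*-cancelˡ x≉0 (trans xy≈0 (sym (zeroʳ x))))

  x*y≈0⇒x≈0⊎y≈0 : ∀ {x y} → x * y ≈ 0# → x ≈ 0# ⊎ y ≈ 0#
  x*y≈0⇒x≈0⊎y≈0 {x} {y} xy≈0 with x ≟ 0# | y ≟ 0#
  ... | yes x≈0 | _       = inj₁ x≈0
  ... | no _    | yes y≈0 = inj₂ y≈0
  ... | no x≉0  | no y≉0  = contradiction xy≈0 (x*y≉0 x≉0 y≉0)

  x*x≈y*y⇒x≈y⊎x≈-y : ∀ {x y} → x * x ≈ y * y → x ≈ y ⊎ x ≈ - y
  x*x≈y*y⇒x≈y⊎x≈-y {x} {y} x²≈y² with x*y≈0⇒x≈0⊎y≈0 {x - y} {x + y} difference-of-squares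
    where
    difference-of-squares : (x - y) * (x + y) ≈ 0#
    difference-of-squares = begin
      (x - y) * (x + y)  ≈⟨ solve 2 (λ x y → (x :- y) :* (x :+ y) := x :* x :- y :* y) refl x y ⟩
      x * x - y * y      ≈⟨ +-congʳ x²≈y² ⟩
      y * y - y * y      ≈⟨ -‿inverseʳ (y * y) ⟩
      0#                 ∎
  ... | inj₁ x-y≈0 = inj₁ (x∙y⁻¹≈ε⇒x≈y x y x-y≈0)
  ... | inj₂ x+y≈0 = inj₂ (+-inverseˡ-unique x y x+y≈0)

  -x≉0 : ∀ {x} → Nonzero x → Nonzero (- x)
  -x≉0 {x} x≉0 -x≈0 = x≉0 (trans (sym (-‿involutive x)) (trans (-‿cong -x≈0) -0#≈0#))

  -x*-x≈x*x : ∀ x → (- x) * (- x) ≈ x * x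
  -x*-x≈x*x = solve 1 (λ x → (:- x) :* (:- x) := x :* x) refl

  square-* : ∀ x y → (x * y) * (x * y) ≈ (x * x) * (y * y)
  square-* = solve 2 (λ x y → (x :* y) :* (x :* y) := (x :* x) :* (y :* y)) refl

  square-root-nonzero : ∀ {s x} → s * s ≈ x → Nonzero x → Nonzero s
  square-root-nonzero {s} s²≈x x≉0 s≈0 = x≉0 (trans (sym s²≈x) (trans (*-congʳ s≈0) (zeroˡ s)))

  -- The junk value 0 ⁻¹ = 0 makes inversion total.
  infix 8 _⁻¹
  _⁻¹ : Carrier → Carrier
  x ⁻¹ with x ≟ 0#
  ... | yes _   = 0#
  ... | no  x≉0 = proj₁ (inverse x x≉0)

  x*x⁻¹≈1 : ∀ {x} → Nonzero x → x * x ⁻¹ ≈ 1#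
  x*x⁻¹≈1 {x} x≉0 with x ≟ 0#
  ... | yes x≈0  = contradiction x≈0 x≉0
  ... | no  x≉0′ = proj₂ (inverse x x≉0′)

  x⁻¹*x≈1 : ∀ {x} → Nonzero x → x ⁻¹ * x ≈ 1#
  x⁻¹*x≈1 {x} x≉0 = trans (*-comm (x ⁻¹) x) (x*x⁻¹≈1 x≉0)

  ⁻¹-unique : ∀ {x y} → Nonzero x → x * y ≈ 1# → y ≈ x ⁻¹
  ⁻¹-unique x≉0 xy≈1 = *-cancelˡ x≉0 (trans xy≈1 (sym (x*x⁻¹≈1 x≉0)))

  x⁻¹≉0 : ∀ {x} → Nonzero x → Nonzero (x ⁻¹)
  x⁻¹≉0 {x} x≉0 x⁻¹≈0 = 1≉0 (trans (sym (x*x⁻¹≈1 x≉0)) (trans (*-congˡ x⁻¹≈0) (zeroʳ x)))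

  ⁻¹-involutive : ∀ {x} → Nonzero x → x ⁻¹ ⁻¹ ≈ x
  ⁻¹-involutive x≉0 = sym (⁻¹-unique (x⁻¹≉0 x≉0) (x⁻¹*x≈1 x≉0))

  ⁻¹-cong : ∀ {x y} → x ≈ y → x ⁻¹ ≈ y ⁻¹
  ⁻¹-cong {x} {y} x≈y with x ≟ 0# | y ≟ 0#
  ... | yes _   | yes _   = refl
  ... | yes x≈0 | no y≉0  = contradiction (trans (sym x≈y) x≈0) y≉0
  ... | no x≉0  | yes y≈0 = contradiction (trans x≈y y≈0) x≉0
  ... | no x≉0  | no y≉0  =
    *-cancelˡ x≉0 (trans (proj₂ (inverse x x≉0)) (sym (trans (*-congʳ x≈y) (proj₂ (inverse y y≉0)))))

  [x*x]⁻¹≈x⁻¹*x⁻¹ : ∀ {x} → Nonzero x → (x * x) ⁻¹ ≈ x ⁻¹ * x ⁻¹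
  [x*x]⁻¹≈x⁻¹*x⁻¹ {x} x≉0 = sym (⁻¹-unique (x*y≉0 x≉0 x≉0) (begin
    (x * x) * (x ⁻¹ * x ⁻¹)    ≈⟨ square-* x (x ⁻¹) ⟨
    (x * x ⁻¹) * (x * x ⁻¹)    ≈⟨ *-cong (x*x⁻¹≈1 x≉0) (x*x⁻¹≈1 x≉0) ⟩
    1# * 1#                    ≈⟨ *-identityˡ 1# ⟩
    1#                         ∎))

  IsSquare-respects : IsSquare Respects _≈_
  IsSquare-respects x≈y (s , s²≈x) = s , trans s²≈x x≈y

  isSquare? : Decidable IsSquare
  isSquare? x = ∃? (λ s≈t s²≈x → trans (*-cong (sym s≈t) (sym s≈t)) s²≈x) (λ s → s * s ≟ x)

  0-isSquare : IsSquare 0#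
  0-isSquare = 0# , zeroˡ 0#

  IsSquare-* : ∀ {x y} → IsSquare x → IsSquare y → IsSquare (x * y)
  IsSquare-* (s , s²≈x) (t , t²≈y) =
    s * t , trans (square-* s t) (*-cong s²≈x t²≈y)

  IsSquare-÷ : ∀ {x z} → Nonzero z → IsSquare z → IsSquare (x * z) → IsSquare x
  IsSquare-÷ {x} {z} z≉0 (s , s²≈z) (r , r²≈xz) = r * s ⁻¹ , (begin
    (r * s ⁻¹) * (r * s ⁻¹)    ≈⟨ square-* r (s ⁻¹) ⟩
    (r * r) * (s ⁻¹ * s ⁻¹)    ≈⟨ *-cong r²≈xz (sym ([x*x]⁻¹≈x⁻¹*x⁻¹ s≉0)) ⟩
    (x * z) * (s * s) ⁻¹       ≈⟨ *-congˡ (⁻¹-cong s²≈z) ⟩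
    (x * z) * z ⁻¹             ≈⟨ *-assoc x z (z ⁻¹) ⟩
    x * (z * z ⁻¹)             ≈⟨ *-congˡ (x*x⁻¹≈1 z≉0) ⟩
    x * 1#                     ≈⟨ *-identityʳ x ⟩
    x                          ∎)
    where
    s≉0 = square-root-nonzero s²≈z z≉0

  SquaresOf : Pred Carrier ℓ₁ → Pred Carrier (c ⊔ ℓ ⊔ ℓ₁)
  SquaresOf P y = ∃ λ s → P s × s * s ≈ y

  SquaresOf-respects : {P : Pred Carrier ℓ₁} → SquaresOf P Respects _≈_
  SquaresOf-respects x≈y (s , Ps , s²≈x) = s , Ps , trans s²≈x x≈y

  squaresOf? : {P : Pred Carrier ℓ₁} → P Respects _≈_ → Decidable P → Decidable (SquaresOf P)
  squaresOf? resp P? y =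
    ∃? (λ s≈t (Ps , s²≈y) → resp s≈t Ps , trans (*-cong (sym s≈t) (sym s≈t)) s²≈y)
       (λ s → P? s ×-dec (s * s ≟ y))

  SquaresOf-nonzero : {P : Pred Carrier ℓ₁} → (∀ {x} → P x → Nonzero x) →
                      ∀ {y} → SquaresOf P y → Nonzero y
  SquaresOf-nonzero P⇒≉0 (s , Ps , s²≈y) = Nonzero-respects s²≈y (x*y≉0 (P⇒≉0 Ps) (P⇒≉0 Ps))

  module OddCharacteristic (two≉0 : ¬ (two ≈ 0#)) where

    -x≈x⇒x≈0 : ∀ {x} → - x ≈ x → x ≈ 0#
    -x≈x⇒x≈0 {x} -x≈x with x*y≈0⇒x≈0⊎y≈0 {two} {x} two*x≈0
      where
      two*x≈0 : two * x ≈ 0#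
      two*x≈0 = begin
        two * x    ≈⟨ solve 1 (λ x → con (+ 2) :* x := x :+ x) refl x ⟩
        x + x      ≈⟨ +-congʳ -x≈x ⟨
        - x + x    ≈⟨ -‿inverseˡ x ⟩
        0#         ∎
    ... | inj₁ two≈0 = contradiction two≈0 two≉0
    ... | inj₂ x≈0   = x≈0

    squaring-twoToOne : {P : Pred Carrier ℓ₁} → (∀ {x} → P x → Nonzero x) →
                        (∀ {x} → P x → P (- x)) →
                        IsTwoToOne P (SquaresOf P) (λ x → x * x) (λ x → - x)
    squaring-twoToOne P⇒≉0 P-closed = record
      { f-cong = λ x≈y → *-cong x≈y x≈y
      ; orbits = record
        { σ-cong        = -‿cong
        ; closed        = P-closed
        ; involutive    = λ {x} _ → -‿involutive x
        ; fixpoint-free = λ Px -x≈x → P⇒≉0 Px (-x≈x⇒x≈0 -x≈x)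
        }
      ; into   = λ {x} Px → x , Px , refl
      ; onto   = λ sq → sq
      ; f∘σ≈f  = λ {x} _ → -x*-x≈x*x x
      ; fibres = λ _ _ z²≈x² → x*x≈y*y⇒x≈y⊎x≈-y z²≈x²
      }

  odd⇒two≉0 : ¬ (2 ∣ q) → ¬ (two ≈ 0#)
  odd⇒two≉0 2∤q two≈0 = 2∤q (≡.subst (2 ∣_) (#-U U? (λ _ → _)) (#-even U? (λ _ _ → _) shift-by-one))
    where
    shift-by-one : IsFreeInvolutionOn U (_+ 1#)
    shift-by-one = record
      { σ-cong        = +-congʳ
      ; closed        = λ _ → _
      ; involutive    = λ {x} _ → begin
          (x + 1#) + 1#   ≈⟨ +-assoc x 1# 1# ⟩
          x + two         ≈⟨ +-congˡ two≈0 ⟩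
          x + 0#          ≈⟨ +-identityʳ x ⟩
          x               ∎
      ; fixpoint-free = λ {x} _ x+1≈x → 1≉0 (begin
          1#              ≈⟨ solve 2 (λ x o → o := (x :+ o) :- x) refl x 1# ⟩
          (x + 1#) - x    ≈⟨ +-congʳ x+1≈x ⟩
          x - x           ≈⟨ -‿inverseʳ x ⟩
          0#              ∎)
      }

  -- Writing q = 5 + 8t: there are 2 + 4t nonzero squares and 1 + 2t nonzero fourth powers.
  module Mod8 (q%8≡5 : q % 8 ≡ 5) where
    fourthPowerCount squareCount : ℕ
    fourthPowerCount = suc (q / 8 ℕ.+ q / 8)
    squareCount      = fourthPowerCount ℕ.+ fourthPowerCount

    q≡1+2*squareCount : q ≡ suc (squareCount ℕ.+ squareCount)
    q≡1+2*squareCount =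
      ≡.trans (m≡m%n+[m/n]*n q 8) (≡.trans (≡.cong (ℕ._+ q / 8 ℕ.* 8) q%8≡5) (5+8t≡1+4[1+2t] (q / 8)))
      where
      5+8t≡1+4[1+2t] : ∀ t → 5 ℕ.+ t ℕ.* 8 ≡
        suc ((suc (t ℕ.+ t) ℕ.+ suc (t ℕ.+ t)) ℕ.+ (suc (t ℕ.+ t) ℕ.+ suc (t ℕ.+ t)))
      5+8t≡1+4[1+2t] = solve-∀

    two≉0 : ¬ (two ≈ 0#)
    two≉0 = odd⇒two≉0 λ 2∣q →
      2∣n⇒2∤1+n (2∣n+n squareCount) (≡.subst (2 ∣_) q≡1+2*squareCount 2∣q)

    open OddCharacteristic two≉0 public

    NonzeroSquare : Pred Carrier (c ⊔ ℓ)
    NonzeroSquare = SquaresOf Nonzero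

    nonzeroSquare? : Decidable NonzeroSquare
    nonzeroSquare? = squaresOf? Nonzero-respects nonzero?

    NonzeroSquare⇒Nonzero : ∀ {y} → NonzeroSquare y → Nonzero y
    NonzeroSquare⇒Nonzero = SquaresOf-nonzero (λ s≉0 → s≉0)

    #Nonzero : q ≡ suc (# nonzero?)
    #Nonzero = ≡.trans (≡.sym (#-U U? (λ _ → _))) (≡.trans (#-remove U? (λ _ _ → _) {0#} _)
      (≡.cong suc (#-cong (U? ─? 0#) nonzero? ((λ (_ , x≉0) → x≉0) , λ x≉0 → _ , x≉0))))

    #NonzeroSquare : # nonzeroSquare? ≡ squareCount
    #NonzeroSquare = +-halve (ℕ.suc-injective (≡.trans (≡.sym q≡1+2S) q≡1+2*squareCount))
      where
      q≡1+2S : q ≡ suc (# nonzeroSquare? ℕ.+ # nonzeroSquare?)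
      q≡1+2S = ≡.trans #Nonzero (≡.cong suc (#-twoToOne nonzero? nonzeroSquare? Nonzero-respects
                 SquaresOf-respects (squaring-twoToOne (λ x≉0 → x≉0) -x≉0)))

    -- Inversion pairs off the nonzero squares other than 1 and, unless it is a square, −1.
    -1-isSquare : IsSquare (- 1#)
    -1-isSquare with isSquare? (- 1#)
    ... | yes -1-square    = -1-square
    ... | no  -1-nonsquare =
      contradiction (≡.subst (2 ∣_) S≡1+#P (2∣n+n fourthPowerCount))
        (2∣n⇒2∤1+n (#-even (nonzeroSquare? ─? 1#) (─-respects SquaresOf-respects) inversion))
      where
      S≡1+#P : squareCount ≡ suc (# (nonzeroSquare? ─? 1#))
      S≡1+#P = ≡.trans (≡.sym #NonzeroSquare)
        (#-remove nonzeroSquare? SquaresOf-respects (1# , 1≉0 , *-identityˡ 1#))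
      1⁻¹≈1 : 1# ⁻¹ ≈ 1#
      1⁻¹≈1 = sym (⁻¹-unique 1≉0 (*-identityˡ 1#))
      inversion : IsFreeInvolutionOn (NonzeroSquare ─ 1#) _⁻¹
      inversion = record
        { σ-cong        = ⁻¹-cong
        ; closed        = λ (y∈□@(s , s≉0 , s²≈y) , y≉1) →
            (s ⁻¹ , x⁻¹≉0 s≉0 , trans (sym ([x*x]⁻¹≈x⁻¹*x⁻¹ s≉0)) (⁻¹-cong s²≈y))
            , λ y⁻¹≈1 → y≉1 (trans (sym (⁻¹-involutive (NonzeroSquare⇒Nonzero y∈□)))
                                   (trans (⁻¹-cong y⁻¹≈1) 1⁻¹≈1))
        ; involutive    = λ (y∈□ , _) → ⁻¹-involutive (NonzeroSquare⇒Nonzero y∈□)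
        ; fixpoint-free = λ (y∈□@(s , _ , s²≈y) , y≉1) y⁻¹≈y →
            [ y≉1 , (λ y≈-1 → -1-nonsquare (s , trans s²≈y y≈-1)) ]
              (x*x≈y*y⇒x≈y⊎x≈-y (trans (*-congˡ (sym y⁻¹≈y))
                (trans (x*x⁻¹≈1 (NonzeroSquare⇒Nonzero y∈□)) (sym (*-identityˡ 1#)))))
        }

    ι : Carrier
    ι = proj₁ -1-isSquare

    ι*ι≈-1 : ι * ι ≈ - 1#
    ι*ι≈-1 = proj₂ -1-isSquare

    ι≉0 : Nonzero ι
    ι≉0 = square-root-nonzero ι*ι≈-1 (-x≉0 1≉0)

    [ιx]²≈-x² : ∀ x → (ι * x) * (ι * x) ≈ - (x * x)
    [ιx]²≈-x² x = begin
      (ι * x) * (ι * x)    ≈⟨ square-* ι x ⟩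
      (ι * ι) * (x * x)    ≈⟨ *-congʳ ι*ι≈-1 ⟩
      - 1# * (x * x)       ≈⟨ -1*x≈-x (x * x) ⟩
      - (x * x)            ∎

    -isSquare : ∀ {x} → IsSquare x → IsSquare (- x)
    -isSquare (s , s²≈x) = ι * s , trans ([ιx]²≈-x² s) (-‿cong s²≈x)

    -- If ι = j², then −1 = j⁴ and negation would pair off the 1 + 2t nonzero fourth powers.
    ι-nonsquare : ¬ IsSquare ι
    ι-nonsquare (j , j²≈ι) =
      contradiction (≡.subst (2 ∣_) #FourthPower (#-even fourthPower? SquaresOf-respects negation))
        (2∣n⇒2∤1+n (2∣n+n (q / 8)))
      where
      FourthPower : Pred Carrier (c ⊔ ℓ)
      FourthPower = SquaresOf NonzeroSquare
      fourthPower? : Decidable FourthPower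
      fourthPower? = squaresOf? SquaresOf-respects nonzeroSquare?
      NonzeroSquare-closed : ∀ {y} → NonzeroSquare y → NonzeroSquare (- y)
      NonzeroSquare-closed (s , s≉0 , s²≈y) =
        ι * s , x*y≉0 ι≉0 s≉0 , trans ([ιx]²≈-x² s) (-‿cong s²≈y)
      #FourthPower : # fourthPower? ≡ fourthPowerCount
      #FourthPower = +-halve (≡.trans (≡.sym (#-twoToOne nonzeroSquare? fourthPower?
        SquaresOf-respects SquaresOf-respects
        (squaring-twoToOne NonzeroSquare⇒Nonzero NonzeroSquare-closed))) #NonzeroSquare)
      negation : IsFreeInvolutionOn FourthPower (λ y → - y)
      negation = record
        { σ-cong        = -‿cong
        ; closed        = λ (v , (r , r≉0 , r²≈v) , v²≈y) →
            ι * v , (j * r , x*y≉0 j≉0 r≉0 , trans (square-* j r) (*-cong j²≈ι r²≈v))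
            , trans ([ιx]²≈-x² v) (-‿cong v²≈y)
        ; involutive    = λ {y} _ → -‿involutive y
        ; fixpoint-free = λ fourth -y≈y →
            SquaresOf-nonzero NonzeroSquare⇒Nonzero fourth (-x≈x⇒x≈0 -y≈y)
        }
        where
        j≉0 = square-root-nonzero j²≈ι ι≉0

    nonsquare⇒nonzero : ∀ {x} → ¬ IsSquare x → Nonzero x
    nonsquare⇒nonzero x∉□ x≈0 = x∉□ (IsSquare-respects (sym x≈0) 0-isSquare)

    -- Multiplication by x maps the nonzero squares injectively into the equally many nonsquares.
    nonsquare*nonsquare-isSquare : ∀ {x y} → ¬ IsSquare x → ¬ IsSquare y → IsSquare (x * y)
    nonsquare*nonsquare-isSquare {x} {y} x∉□ y∉□ =
      IsSquare-respects (*-congˡ xz≈y) (IsSquare-respects (*-assoc x x z) (IsSquare-* (x , refl) z∈□))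
      where
      Nonsquare : Pred Carrier (c ⊔ ℓ)
      Nonsquare = Nonzero ∖ IsSquare
      nonsquare? : Decidable Nonsquare
      nonsquare? = nonzero? ∖? isSquare?
      #Nonsquare : # nonzeroSquare? ≡ # nonsquare?
      #Nonsquare = ℕ.+-cancelˡ-≡ (# nonzeroSquare?) _ _ (≡.trans (≡.sym N≡2S) (≡.trans
        (#-split nonzero? isSquare?)
        (≡.cong (ℕ._+ # nonsquare?) (#-cong (nonzero? ∩? isSquare?) nonzeroSquare?
          ( (λ (y≉0 , s , s²≈y) → s , square-root-nonzero s²≈y y≉0 , s²≈y)
          , (λ y∈□@(s , _ , s²≈y) → NonzeroSquare⇒Nonzero y∈□ , s , s²≈y))))))
        where
        N≡2S : # nonzero? ≡ # nonzeroSquare? ℕ.+ # nonzeroSquare?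
        N≡2S = #-twoToOne nonzero? nonzeroSquare? Nonzero-respects SquaresOf-respects
                 (squaring-twoToOne (λ x≉0 → x≉0) -x≉0)
      x≉0 = nonsquare⇒nonzero x∉□
      times-x : IsInjectionInto NonzeroSquare Nonsquare (x *_)
      times-x = record
        { f-cong    = *-congˡ
        ; into      = λ z∈□@(s , _ , s²≈z) →
            x*y≉0 x≉0 (NonzeroSquare⇒Nonzero z∈□)
            , λ xz∈□ → x∉□ (IsSquare-÷ (NonzeroSquare⇒Nonzero z∈□) (s , s²≈z) xz∈□)
        ; injective = λ _ _ → *-cancelˡ x≉0
        }
      preimage = #-injection-onto nonzeroSquare? nonsquare? SquaresOf-respects
        (λ z≈w (z≉0 , z∉□) →
          Nonzero-respects z≈w z≉0 , λ w∈□ → z∉□ (IsSquare-respects (sym z≈w) w∈□))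
        times-x #Nonsquare (nonsquare⇒nonzero y∉□ , y∉□)
      z = proj₁ preimage
      z∈□ : IsSquare z
      z∈□ = let (s , _ , s²≈z) = proj₁ (proj₂ preimage) in s , s²≈z
      xz≈y : x * z ≈ y
      xz≈y = proj₂ (proj₂ preimage)

    ι*square-nonsquare : ∀ {x w} → Nonzero w → x ≈ ι * (w * w) → ¬ IsSquare x
    ι*square-nonsquare w≉0 x≈ιw² x∈□ =
      ι-nonsquare (IsSquare-÷ (x*y≉0 w≉0 w≉0) (_ , refl) (IsSquare-respects x≈ιw² x∈□))

    exactly-one-isSquare : ∀ {x y w} → Nonzero w → x * y ≈ ι * (w * w) →
                           (IsSquare x × ¬ IsSquare y) ⊎ (¬ IsSquare x × IsSquare y)
    exactly-one-isSquare {x} {y} w≉0 xy≈ιw² with isSquare? x | isSquare? y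
    ... | yes x∈□ | yes y∈□ = contradiction (IsSquare-* x∈□ y∈□) xy∉□
      where xy∉□ = ι*square-nonsquare w≉0 xy≈ιw²
    ... | yes x∈□ | no  y∉□ = inj₁ (x∈□ , y∉□)
    ... | no  x∉□ | yes y∈□ = inj₂ (x∉□ , y∈□)
    ... | no  x∉□ | no  y∉□ = contradiction (nonsquare*nonsquare-isSquare x∉□ y∉□) xy∉□
      where xy∉□ = ι*square-nonsquare w≉0 xy≈ιw²

module AquariumProperties {c ℓ : Level} {q : ℕ} (F : FiniteField c ℓ q) (q%8≡5 : q % 8 ≡ 5) where
  open import Data.Integer using (+_)
  open FiniteField F
  open Aquarium F
  open FiniteFieldProperties F
  open Mod8 q%8≡5
  open IntegerCoefficientSolver commRing using (solve; _:=_; _:+_; _:*_; _:-_; :-_; con)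
  open import Algebra.Properties.Ring ring
    using (-‿involutive; -‿distribʳ-*; x∙y⁻¹≈ε⇒x≈y; +-inverseˡ-unique; +-cancelˡ)
  open import Relation.Binary.Reasoning.Setoid setoid

  ½ : Carrier
  ½ = two ⁻¹

  two*½x≈x : ∀ x → two * (½ * x) ≈ x
  two*½x≈x x = trans (sym (*-assoc two ½ x)) (trans (*-congʳ (x*x⁻¹≈1 two≉0)) (*-identityˡ x))

  two*x≈y⇒x≈½y : ∀ {x y} → two * x ≈ y → x ≈ ½ * y
  two*x≈y⇒x≈½y {x} {y} two*x≈y = *-cancelˡ two≉0 (trans two*x≈y (sym (two*½x≈x y)))

  HasSuccessor : Pred Vertex (c ⊔ ℓ)
  HasSuccessor v = IsSquare (a v * b v)

  HasPredecessor : Pred Vertex (c ⊔ ℓ)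
  HasPredecessor v = IsSquare (a v * a v - b v * b v)

  a*b≉0 : ∀ v → Nonzero (a v * b v)
  a*b≉0 v = x*y≉0 (a≉0 v) (b≉0 v)

  am≉gm : ∀ v {x} → two * x ≈ a v + b v → x * x ≈ a v * b v → ⊥
  am≉gm v {x} two*x≈a+b x²≈ab = a≉b v (x∙y⁻¹≈ε⇒x≈y (a v) (b v) [a-b]≈0)
    where
    [a-b]²≈0 : (a v - b v) * (a v - b v) ≈ 0#
    [a-b]²≈0 = begin
      (a v - b v) * (a v - b v)
        ≈⟨ solve 2 (λ a b → (a :- b) :* (a :- b) := (a :+ b) :* (a :+ b) :- con (+ 4) :* (a :* b))
                   refl (a v) (b v) ⟩
      (a v + b v) * (a v + b v) - (1# + 1# + 1# + 1#) * (a v * b v)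
        ≈⟨ +-cong (*-cong two*x≈a+b two*x≈a+b) (-‿cong (*-congˡ x²≈ab)) ⟨
      (two * x) * (two * x) - (1# + 1# + 1# + 1#) * (x * x)
        ≈⟨ solve 1 (λ x → (con (+ 2) :* x) :* (con (+ 2) :* x) :- con (+ 4) :* (x :* x) := con (+ 0)) refl x ⟩
      0#
        ∎
    [a-b]≈0 : a v - b v ≈ 0#
    [a-b]≈0 = Sum.reduce (x*y≈0⇒x≈0⊎y≈0 [a-b]²≈0)

  -- Edge and _≋_ unfold to conditions on coordinates, from which Agda cannot infer the vertices;
  -- these record wrappers keep the vertices visible to unification.
  record _↦_ (v w : Vertex) : Set (c ⊔ ℓ) where
    constructor edge
    field isEdge : Edge v w

  record _≅_ (v w : Vertex) : Set ℓ where
    constructor same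
    field isSame : v ≋ w

  open _↦_
  open _≅_

  ≅-refl : ∀ {v} → v ≅ v
  ≅-refl = same (refl , refl)

  ≅-sym : ∀ {v w} → v ≅ w → w ≅ v
  ≅-sym (same (a≈ , b≈)) = same (sym a≈ , sym b≈)

  child : (v : Vertex) (s : Carrier) → s * s ≈ a v * b v → Vertex
  child v s s²≈ab = vtx (½ * (a v + b v)) s mean≉0 s≉0 mean≉s mean≉-s
    where
    mean≉0 : Nonzero (½ * (a v + b v))
    mean≉0 mean≈0 = a≉-b v (+-inverseˡ-unique (a v) (b v)
      (trans (sym (two*½x≈x _)) (trans (*-congˡ mean≈0) (zeroʳ two))))
    s≉0 : Nonzero s
    s≉0 = square-root-nonzero s²≈ab (a*b≉0 v)
    mean≉s : ¬ (½ * (a v + b v) ≈ s)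
    mean≉s mean≈s = am≉gm v (two*½x≈x _) (trans (*-cong mean≈s mean≈s) s²≈ab)
    mean≉-s : ¬ (½ * (a v + b v) ≈ - s)
    mean≉-s mean≈-s =
      am≉gm v (two*½x≈x _) (trans (*-cong mean≈-s mean≈-s) (trans (-x*-x≈x*x s) s²≈ab))

  child-edge : ∀ v s (s²≈ab : s * s ≈ a v * b v) → v ↦ child v s s²≈ab
  child-edge v s s²≈ab = edge ((s , s²≈ab) , two*½x≈x _ , s²≈ab)

  two*x≈[x+y]+[x-y] : ∀ x y → two * x ≈ (x + y) + (x - y)
  two*x≈[x+y]+[x-y] = solve 2 (λ x y → con (+ 2) :* x := (x :+ y) :+ (x :- y)) refl

  b²≈a²-d² : ∀ v {d} → d * d ≈ a v * a v - b v * b v → b v * b v ≈ a v * a v - d * d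
  b²≈a²-d² v {d} d²≈a²-b² = begin
    b v * b v
      ≈⟨ solve 2 (λ a b → b :* b := a :* a :- (a :* a :- b :* b)) refl (a v) (b v) ⟩
    a v * a v - (a v * a v - b v * b v)
      ≈⟨ +-congˡ (-‿cong d²≈a²-b²) ⟨
    a v * a v - d * d
      ∎

  parent : (v : Vertex) (d : Carrier) → d * d ≈ a v * a v - b v * b v → Vertex
  parent v d d²≈a²-b² = vtx (a v + d) (a v - d) a+d≉0 a-d≉0 a+d≉a-d a+d≉-[a-d]
    where
    d²≉a² : ¬ (d * d ≈ a v * a v)
    d²≉a² d²≈a² = x*y≉0 (b≉0 v) (b≉0 v) (begin
      b v * b v                            ≈⟨ b²≈a²-d² v d²≈a²-b² ⟩
      a v * a v - d * d                    ≈⟨ +-congˡ (-‿cong d²≈a²) ⟩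
      a v * a v - a v * a v                ≈⟨ -‿inverseʳ _ ⟩
      0#                                   ∎)
    a+d≉0 : Nonzero (a v + d)
    a+d≉0 a+d≈0 = d²≉a² (trans (*-cong d≈-a d≈-a) (-x*-x≈x*x (a v)))
      where d≈-a = +-inverseˡ-unique d (a v) (trans (+-comm d (a v)) a+d≈0)
    a-d≉0 : Nonzero (a v - d)
    a-d≉0 a-d≈0 = d²≉a² (*-cong (sym a≈d) (sym a≈d))
      where a≈d = x∙y⁻¹≈ε⇒x≈y (a v) d a-d≈0
    a+d≉a-d : ¬ (a v + d ≈ a v - d)
    a+d≉a-d a+d≈a-d = [ a≉b v , a≉-b v ] (x*x≈y*y⇒x≈y⊎x≈-y
      (x∙y⁻¹≈ε⇒x≈y _ _ (trans (sym d²≈a²-b²) (trans (*-congʳ d≈0) (zeroˡ d)))))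
      where
      d≈0 : d ≈ 0#
      d≈0 = -x≈x⇒x≈0 (begin
        - d                  ≈⟨ solve 2 (λ a d → :- d := (a :- d) :- a) refl (a v) d ⟩
        (a v - d) - a v      ≈⟨ +-congʳ a+d≈a-d ⟨
        (a v + d) - a v      ≈⟨ solve 2 (λ a d → (a :+ d) :- a := d) refl (a v) d ⟩
        d                    ∎)
    a+d≉-[a-d] : ¬ (a v + d ≈ - (a v - d))
    a+d≉-[a-d] a+d≈-[a-d] = [ two≉0 , a≉0 v ] (x*y≈0⇒x≈0⊎y≈0 (begin
      two * a v                 ≈⟨ two*x≈[x+y]+[x-y] (a v) d ⟩
      (a v + d) + (a v - d)     ≈⟨ +-congʳ a+d≈-[a-d] ⟩
      - (a v - d) + (a v - d)   ≈⟨ -‿inverseˡ _ ⟩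
      0#                        ∎))

  parent-edge : ∀ v d (d²≈a²-b² : d * d ≈ a v * a v - b v * b v) → parent v d d²≈a²-b² ↦ v
  parent-edge v d d²≈a²-b² = edge ((b v , b²≈[a+d][a-d]) , two*x≈[x+y]+[x-y] (a v) d , b²≈[a+d][a-d])
    where
    b²≈[a+d][a-d] : b v * b v ≈ (a v + d) * (a v - d)
    b²≈[a+d][a-d] = begin
      b v * b v                            ≈⟨ b²≈a²-d² v d²≈a²-b² ⟩
      a v * a v - d * d                    ≈⟨ solve 2 (λ a d → a :* a :- d :* d := (a :+ d) :* (a :- d))
                                                     refl (a v) d ⟩
      (a v + d) * (a v - d)                ∎

  neg : Vertex → Vertex
  neg v = vtx (a v) (- b v) (a≉0 v) (-x≉0 (b≉0 v)) (a≉-b v)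
    (λ a≈--b → a≉b v (trans a≈--b (-‿involutive (b v))))

  swap : Vertex → Vertex
  swap v = vtx (b v) (a v) (b≉0 v) (a≉0 v) (a≉b v ∘ sym)
    (λ b≈-a → a≉-b v (trans (sym (-‿involutive (a v))) (-‿cong (sym b≈-a))))

  ↦-cong : ∀ {v v′ w w′} → v ≅ v′ → w ≅ w′ → v ↦ w → v′ ↦ w′
  ↦-cong (same (av≈ , bv≈)) (same (aw≈ , bw≈)) (edge (ab∈□ , two*a≈a+b , b²≈ab)) = edge $
    IsSquare-respects (*-cong av≈ bv≈) ab∈□
    , trans (*-congˡ (sym aw≈)) (trans two*a≈a+b (+-cong av≈ bv≈))
    , trans (*-cong (sym bw≈) (sym bw≈)) (trans b²≈ab (*-cong av≈ bv≈))

  ↦-neg : ∀ {v w} → v ↦ w → v ↦ neg w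
  ↦-neg (edge (ab∈□ , two*a≈a+b , b²≈ab)) = edge (ab∈□ , two*a≈a+b , trans (-x*-x≈x*x _) b²≈ab)

  ↦-swap : ∀ {v w} → v ↦ w → swap v ↦ w
  ↦-swap (edge (ab∈□ , two*a≈a+b , b²≈ab)) = edge $
    IsSquare-respects (*-comm _ _) ab∈□ , trans two*a≈a+b (+-comm _ _) , trans b²≈ab (*-comm _ _)

  ↦⇒≇ : ∀ {v w} → v ↦ w → ¬ (v ≅ w)
  ↦⇒≇ {v} (edge (_ , two*a≈a+b , _)) (same (a≈ , _)) = a≉b v (+-cancelˡ (a v) (a v) (b v) (begin
    a v + a v    ≈⟨ solve 1 (λ x → x :+ x := con (+ 2) :* x) refl (a v) ⟩
    two * a v    ≈⟨ *-congˡ a≈ ⟩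
    _            ≈⟨ two*a≈a+b ⟩
    a v + b v    ∎))

  ↦⇒HasSuccessor : ∀ {v w} → v ↦ w → HasSuccessor v
  ↦⇒HasSuccessor = proj₁ ∘ isEdge

  ↦⇒HasPredecessor : ∀ {v w} → v ↦ w → HasPredecessor w
  ↦⇒HasPredecessor {v} {w} (edge (_ , two*aw≈a+b , bw²≈ab)) = ½ * (a v - b v) , (begin
    (½ * (a v - b v)) * (½ * (a v - b v))              ≈⟨ half-difference² ⟩
    (½ * (a v + b v)) * (½ * (a v + b v)) - a v * b v  ≈⟨ +-cong (*-cong aw≈ aw≈) (-‿cong bw²≈ab) ⟨
    a w * a w - b w * b w                              ∎)
    where
    aw≈ : a w ≈ ½ * (a v + b v)
    aw≈ = two*x≈y⇒x≈½y two*aw≈a+b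
    half-difference² : (½ * (a v - b v)) * (½ * (a v - b v)) ≈ (½ * (a v + b v)) * (½ * (a v + b v)) - a v * b v
    half-difference² = begin
      (½ * (a v - b v)) * (½ * (a v - b v))
        ≈⟨ solve 3 (λ h x y → (h :* (x :- y)) :* (h :* (x :- y))
                     := (h :* (x :+ y)) :* (h :* (x :+ y)) :- ((h :* con (+ 2)) :* (h :* con (+ 2))) :* (x :* y))
                   refl ½ (a v) (b v) ⟩
      (½ * (a v + b v)) * (½ * (a v + b v)) - ((½ * two) * (½ * two)) * (a v * b v)
        ≈⟨ +-congˡ (-‿cong (*-congʳ (trans (*-cong ½*two≈1 ½*two≈1) (*-identityˡ 1#)))) ⟩
      (½ * (a v + b v)) * (½ * (a v + b v)) - 1# * (a v * b v)
        ≈⟨ +-congˡ (-‿cong (*-identityˡ _)) ⟩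
      (½ * (a v + b v)) * (½ * (a v + b v)) - a v * b v
        ∎
      where ½*two≈1 = x⁻¹*x≈1 two≉0

  successors : ∀ {v w w′} → v ↦ w → v ↦ w′ → w′ ≅ w ⊎ w′ ≅ neg w
  successors (edge (_ , two*a≈ , b²≈)) (edge (_ , two*a′≈ , b′²≈)) =
    Sum.map (same ∘ (aw′≈aw ,_)) (same ∘ (aw′≈aw ,_))
      (x*x≈y*y⇒x≈y⊎x≈-y (trans b′²≈ (sym b²≈)))
    where aw′≈aw = *-cancelˡ two≉0 (trans two*a′≈ (sym two*a≈))

  predecessors : ∀ {p p′ w} → p ↦ w → p′ ↦ w → p′ ≅ p ⊎ p′ ≅ swap p
  predecessors {p} {p′} (edge (_ , two*a≈ , b²≈)) (edge (_ , two*a≈′ , b²≈′)) =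
    Sum.map (λ a′≈a → same (a′≈a , other-root a′≈a refl))
            (λ a′≈b → same (a′≈b , other-root a′≈b (+-comm (b p) (a p))))
            (Sum.map (x∙y⁻¹≈ε⇒x≈y _ _) (x∙y⁻¹≈ε⇒x≈y _ _) (x*y≈0⇒x≈0⊎y≈0 root-product))
    where
    a′+b′≈a+b : a p′ + b p′ ≈ a p + b p
    a′+b′≈a+b = trans (sym two*a≈′) two*a≈
    a′b′≈ab : a p′ * b p′ ≈ a p * b p
    a′b′≈ab = trans (sym b²≈′) b²≈
    root-product : (a p′ - a p) * (a p′ - b p) ≈ 0#
    root-product = begin
      (a p′ - a p) * (a p′ - b p)
        ≈⟨ solve 3 (λ x y z → (x :- y) :* (x :- z) := x :* x :- x :* (y :+ z) :+ y :* z)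
                   refl (a p′) (a p) (b p) ⟩
      a p′ * a p′ - a p′ * (a p + b p) + a p * b p
        ≈⟨ +-cong (+-congˡ (-‿cong (*-congˡ a′+b′≈a+b))) a′b′≈ab ⟨
      a p′ * a p′ - a p′ * (a p′ + b p′) + a p′ * b p′
        ≈⟨ solve 2 (λ x y → x :* x :- x :* (x :+ y) :+ x :* y := con (+ 0)) refl (a p′) (b p′) ⟩
      0#
        ∎
    other-root : ∀ {x y} → a p′ ≈ x → x + y ≈ a p + b p → b p′ ≈ y
    other-root {x} {y} a′≈x x+y≈a+b =
      +-cancelˡ (a p′) (b p′) y (trans a′+b′≈a+b (trans (sym x+y≈a+b) (+-congʳ (sym a′≈x))))

  HasSuccessor-cong : ∀ {v w} → v ≅ w → HasSuccessor v → HasSuccessor w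
  HasSuccessor-cong (same (a≈ , b≈)) = IsSquare-respects (*-cong a≈ b≈)

  HasPredecessor-cong : ∀ {v w} → v ≅ w → HasPredecessor v → HasPredecessor w
  HasPredecessor-cong (same (a≈ , b≈)) = IsSquare-respects (+-cong (*-cong a≈ a≈) (-‿cong (*-cong b≈ b≈)))

  HasSuccessor-neg⁻ : ∀ v → HasSuccessor (neg v) → HasSuccessor v
  HasSuccessor-neg⁻ v =
    IsSquare-respects (trans (-‿cong (sym (-‿distribʳ-* _ _))) (-‿involutive _)) ∘ -isSquare

  HasPredecessor-swap⁻ : ∀ v → HasPredecessor (swap v) → HasPredecessor v
  HasPredecessor-swap⁻ v = IsSquare-respects
    (solve 2 (λ x y → :- (y :* y :- x :* x) := x :* x :- y :* y) refl (a v) (b v)) ∘ -isSquare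

  forward : ∀ {v w} → v ↦ w → Connected v w
  forward v↦w = inj₁ (isEdge v↦w) ◅ ε

  backward : ∀ {v w} → w ↦ v → Connected v w
  backward w↦v = inj₂ (isEdge w↦v) ◅ ε

  module Fish {p c : Vertex} (p↦c : p ↦ c) (p-source : ¬ HasPredecessor p) (c-sink : ¬ HasSuccessor c) where

    InFish : Pred Vertex ℓ
    InFish u = u ≅ p ⊎ u ≅ swap p ⊎ u ≅ c ⊎ u ≅ neg c

    InFish-step : ∀ {w x} → InFish w → w ↦ x ⊎ x ↦ w → InFish x
    InFish-step (inj₁ w≅p) (inj₁ w↦x) =
      inj₂ (inj₂ (successors p↦c (↦-cong w≅p ≅-refl w↦x)))
    InFish-step (inj₁ w≅p) (inj₂ x↦w) =
      contradiction (HasPredecessor-cong w≅p (↦⇒HasPredecessor x↦w)) p-source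
    InFish-step (inj₂ (inj₁ w≅p′)) (inj₁ w↦x) =
      inj₂ (inj₂ (successors (↦-swap p↦c) (↦-cong w≅p′ ≅-refl w↦x)))
    InFish-step (inj₂ (inj₁ w≅p′)) (inj₂ x↦w) =
      contradiction (HasPredecessor-swap⁻ p (HasPredecessor-cong w≅p′ (↦⇒HasPredecessor x↦w))) p-source
    InFish-step (inj₂ (inj₂ (inj₁ w≅c))) (inj₁ w↦x) =
      contradiction (HasSuccessor-cong w≅c (↦⇒HasSuccessor w↦x)) c-sink
    InFish-step (inj₂ (inj₂ (inj₁ w≅c))) (inj₂ x↦w) =
      Sum.map₂ inj₁ (predecessors p↦c (↦-cong ≅-refl w≅c x↦w))
    InFish-step (inj₂ (inj₂ (inj₂ w≅c′))) (inj₁ w↦x) =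
      contradiction (HasSuccessor-neg⁻ c (HasSuccessor-cong w≅c′ (↦⇒HasSuccessor w↦x))) c-sink
    InFish-step (inj₂ (inj₂ (inj₂ w≅c′))) (inj₂ x↦w) =
      Sum.map₂ inj₁ (predecessors (↦-neg p↦c) (↦-cong ≅-refl w≅c′ x↦w))

    InFish-closed : ∀ {w u} → InFish w → Connected w u → InFish u
    InFish-closed w∈ ε = w∈
    InFish-closed {w} w∈ (_◅_ {j = x} w─x x⇝u) =
      InFish-closed (InFish-step w∈ (Sum.map (edge {w} {x}) (edge {x} {w}) w─x)) x⇝u

    fishComponent : ∀ {v} → Connected p v → IsFishComponent v
    fishComponent {v} p⇝v =
      p , swap p , c , neg c
      , ( v⇝p , v⇝p ◅◅ forward p↦c ◅◅ backward (↦-swap p↦c) , v⇝p ◅◅ forward p↦c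
        , v⇝p ◅◅ forward (↦-neg p↦c))
      , ( (λ (a≈b , _) → a≉b p a≈b) , ≉ p↦c , ≉ (↦-neg p↦c)
        , ≉ (↦-swap p↦c) , ≉ (↦-swap (↦-neg p↦c))
        , λ (_ , b≈-b) → b≉0 c (-x≈x⇒x≈0 (sym b≈-b)))
      , λ u v⇝u → Sum.map isSame (Sum.map isSame (Sum.map isSame isSame))
                    (InFish-closed (inj₁ ≅-refl) (p⇝v ◅◅ v⇝u))
      where
      v⇝p : Connected v p
      v⇝p = reverse Sum.swap p⇝v
      ≉ : ∀ {x y} → x ↦ y → ¬ (x ≋ y)
      ≉ x↦y = ↦⇒≇ x↦y ∘ same

  a²-b²≉0 : ∀ v → Nonzero (a v * a v - b v * b v)
  a²-b²≉0 v a²-b²≈0 =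
    [ a≉b v , a≉-b v ] (x*x≈y*y⇒x≈y⊎x≈-y (x∙y⁻¹≈ε⇒x≈y _ _ a²-b²≈0))

  ι-root : ∀ w {t} → t * t ≈ a w * b w → (ι * t) * (ι * t) ≈ a (neg w) * b (neg w)
  ι-root w {t} t²≈ab = trans ([ιx]²≈-x² t) (trans (-‿cong t²≈ab) (-‿distribʳ-* (a w) (b w)))

  exactly-one-branch : ∀ w → HasPredecessor w → ∀ t (t²≈ab : t * t ≈ a w * b w) →
    let w₊ = child w t t²≈ab ; w₋ = child (neg w) (ι * t) (ι-root w t²≈ab) in
    (HasSuccessor w₊ × ¬ HasSuccessor w₋) ⊎ (¬ HasSuccessor w₊ × HasSuccessor w₋)
  exactly-one-branch w (e , e²≈a²-b²) t t²≈ab =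
    exactly-one-isSquare r≉0 (begin
      ((½ * (A + B)) * t) * ((½ * (A - B)) * (ι * t))
        ≈⟨ solve 5 (λ h A B t i → ((h :* (A :+ B)) :* t) :* ((h :* (A :- B)) :* (i :* t))
                                  := (i :* ((h :* t) :* (h :* t))) :* (A :* A :- B :* B)) refl ½ A B t ι ⟩
      (ι * ((½ * t) * (½ * t))) * (A * A - B * B)
        ≈⟨ *-congˡ e²≈a²-b² ⟨
      (ι * ((½ * t) * (½ * t))) * (e * e)
        ≈⟨ solve 4 (λ h e t i → (i :* ((h :* t) :* (h :* t))) :* (e :* e)
                                := i :* (((h :* e) :* t) :* ((h :* e) :* t))) refl ½ e t ι ⟩
      ι * (r * r)
        ∎)
    where
    A = a w
    B = b w
    r = (½ * e) * t
    r≉0 : Nonzero r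
    r≉0 = x*y≉0 (x*y≉0 (x⁻¹≉0 two≉0) (square-root-nonzero e²≈a²-b² (a²-b²≉0 w)))
                (square-root-nonzero t²≈ab (a*b≉0 w))

  HasGrandchild : Pred Vertex (c ⊔ ℓ)
  HasGrandchild v = ∃ λ w → v ↦ w × HasSuccessor w

  -- Abstract, so that the walk below never unfolds the square-class proofs inside a step.
  abstract
    HasGrandchild-step : ∀ {v} → HasGrandchild v → ∃ λ w → v ↦ w × HasGrandchild w
    HasGrandchild-step (w , v↦w , t , t²≈ab) =
      [ (λ (w₊↦ , _) → w , v↦w , _ , child-edge w t t²≈ab , w₊↦)
      , (λ (_ , w₋↦) → neg w , ↦-neg v↦w , _ , child-edge (neg w) (ι * t) (ι-root w t²≈ab) , w₋↦)
      ] (exactly-one-branch w (↦⇒HasPredecessor v↦w) t t²≈ab)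

  Reach-≅ : ∀ {u y w} → Reach u y → y ≅ w → u ≅ w ⊎ Reach u w
  Reach-≅ ε y≅w = inj₁ y≅w
  Reach-≅ {u} (_◅_ {j = m} u→m m↠y) y≅w with Reach-≅ m↠y y≅w
  ... | inj₁ m≅w = inj₂ (isEdge (↦-cong ≅-refl m≅w (edge {u} {m} u→m)) ◅ ε)
  ... | inj₂ m↠w = inj₂ (u→m ◅ m↠w)

  module InfiniteWalk {g : Vertex} (g↠ : HasGrandchild g) where

    walk : ℕ → Σ Vertex HasGrandchild
    walk zero    = g , g↠
    walk (suc n) = proj₁ step , proj₂ (proj₂ step)
      where step = HasGrandchild-step (proj₂ (walk n))

    vertex : ℕ → Vertex
    vertex = proj₁ ∘ walk

    vertex-↦ : ∀ n → vertex n ↦ vertex (suc n)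
    vertex-↦ n = proj₁ (proj₂ (HasGrandchild-step (proj₂ (walk n))))

    vertex-reach : ∀ i k → Reach (vertex i) (vertex (k ℕ.+ i))
    vertex-reach i zero    = ε
    vertex-reach i (suc k) = vertex-reach i k ◅◅ (isEdge (vertex-↦ (k ℕ.+ i)) ◅ ε)

    vertex-connected : ∀ n → Connected g (vertex n)
    vertex-connected zero    = ε
    vertex-connected (suc n) = vertex-connected n ◅◅ forward (vertex-↦ n)

    nontrivialSCC : ∀ {v} → Connected v g → HasNontrivialSCC v
    nontrivialSCC v⇝g with pigeonhole² (a ∘ vertex) (b ∘ vertex)
    ... | i , j , i<j , aᵢ≈aⱼ , bᵢ≈bⱼ =
      vertex i , vertex (suc i) , v⇝g ◅◅ vertex-connected i , v⇝g ◅◅ vertex-connected (suc i)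
      , ↦⇒≇ (vertex-↦ i) ∘ same , isEdge (vertex-↦ i) ◅ ε , back
      where
      k = proj₁ (ℕ.m≤n⇒∃[o]m+o≡n i<j)
      k+[1+i]≡j : k ℕ.+ suc i ≡ j
      k+[1+i]≡j = ≡.trans (ℕ.+-comm k (suc i)) (proj₂ (ℕ.m≤n⇒∃[o]m+o≡n i<j))
      back : Reach (vertex (suc i)) (vertex i)
      back with Reach-≅ (≡.subst (Reach (vertex (suc i)) ∘ vertex) k+[1+i]≡j (vertex-reach (suc i) k))
                        (same (sym aᵢ≈aⱼ , sym bᵢ≈bⱼ))
      ... | inj₁ i+1≅i = contradiction (≅-sym i+1≅i) (↦⇒≇ (vertex-↦ i))
      ... | inj₂ i+1↠i = i+1↠i

  sink-reaches-itself : ∀ {x u} → ¬ HasSuccessor x → Reach x u → x ≡ u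
  sink-reaches-itself x-sink ε           = ≡.refl
  sink-reaches-itself x-sink (x→y ◅ _)  = contradiction (proj₁ x→y) x-sink

  ↦-irreflexive : ∀ {v} → ¬ (v ↦ v)
  ↦-irreflexive v↦v = ↦⇒≇ v↦v ≅-refl

  sink-breaks-strong-connectivity : ∀ {v w x} → w ↦ x → ¬ HasSuccessor x → Connected v w →
                                    ¬ IsStronglyConnectedComponent v
  sink-breaks-strong-connectivity {w = w} {x} w↦x x-sink v⇝w strong =
    ↦-irreflexive (≡.subst (w ↦_) x≡w w↦x)
    where
    x≡w : x ≡ w
    x≡w = sink-reaches-itself {x} x-sink (strong x w (v⇝w ◅◅ forward w↦x) v⇝w)

  jellyfishComponent : ∀ {v w} → HasPredecessor w → HasSuccessor w → Connected v w → IsJellyfishComponent v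
  jellyfishComponent {v} {w} (d , d²≈a²-b²) (t , t²≈ab) v⇝w =
    [ (λ (_ , w₋-sink) → sink-breaks-strong-connectivity (child-edge (neg w) (ι * t) (ι-root w t²≈ab))
                           w₋-sink (v⇝g ◅◅ forward (↦-neg g↦w)))
    , (λ (w₊-sink , _) → sink-breaks-strong-connectivity (child-edge w t t²≈ab) w₊-sink v⇝w)
    ] (exactly-one-branch w (↦⇒HasPredecessor g↦w) t t²≈ab)
    , InfiniteWalk.nontrivialSCC (w , g↦w , t , t²≈ab) v⇝g
    where
    g↦w = parent-edge w d d²≈a²-b²
    v⇝g = v⇝w ◅◅ backward g↦w

  edgeless⇒Connected⇒≡ : ∀ {v w} → ¬ HasSuccessor v → ¬ HasPredecessor v → Connected v w → v ≡ w
  edgeless⇒Connected⇒≡ v-sink v-source ε = ≡.refl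
  edgeless⇒Connected⇒≡ v-sink v-source (inj₁ v→x ◅ _) = contradiction (proj₁ v→x) v-sink
  edgeless⇒Connected⇒≡ {v} v-sink v-source (_◅_ {j = x} (inj₂ x→v) _) =
    contradiction (↦⇒HasPredecessor (edge {x} {v} x→v)) v-source

  isolatedComponent : ∀ {v} → ¬ HasSuccessor v → ¬ HasPredecessor v → IsIsolatedComponent v
  isolatedComponent v-sink v-source w u v⇝w _ w→u
    with ≡.refl ← edgeless⇒Connected⇒≡ v-sink v-source v⇝w = v-sink (proj₁ w→u)

  hasSuccessor? : ∀ v → Dec (HasSuccessor v)
  hasSuccessor? v = isSquare? (a v * b v)

  hasPredecessor? : ∀ v → Dec (HasPredecessor v)
  hasPredecessor? v = isSquare? (a v * a v - b v * b v)

  classification : ∀ v → IsIsolatedComponent v ⊎ IsFishComponent v ⊎ IsJellyfishComponent v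
  classification v with hasSuccessor? v | hasPredecessor? v
  ... | no v-sink | no v-source = inj₁ (isolatedComponent v-sink v-source)
  ... | yes v↦    | yes v-pred  = inj₂ (inj₂ (jellyfishComponent v-pred v↦ ε))
  ... | yes (s , s²≈ab) | no v-source with hasSuccessor? (child v s s²≈ab)
  ...   | yes c↦    = inj₂ (inj₂ (jellyfishComponent (↦⇒HasPredecessor v↦c) c↦ (forward v↦c)))
    where v↦c = child-edge v s s²≈ab
  ...   | no c-sink = inj₂ (inj₁ (Fish.fishComponent (child-edge v s s²≈ab) v-source c-sink ε))
  classification v | no v-sink | yes (d , d²≈a²-b²) with hasPredecessor? (parent v d d²≈a²-b²)
  ...   | yes p-pred   = inj₂ (inj₂ (jellyfishComponent p-pred (↦⇒HasSuccessor p↦v) (backward p↦v)))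
    where p↦v = parent-edge v d d²≈a²-b²
  ...   | no  p-source = inj₂ (inj₁ (Fish.fishComponent p↦v p-source v-sink (forward p↦v)))
    where p↦v = parent-edge v d d²≈a²-b²

-- Only |F| = q and q ≡ 5 (mod 8) are used; that q is a prime power follows from the existence of F.
proposition4p12 : {c ℓ : Level} (q : ℕ) → IsPrimePower q → q % 8 ≡ 5 →
    (F : FiniteField c ℓ q) → (v : Aquarium.Vertex F) →
      Aquarium.IsIsolatedComponent F v
      ⊎ Aquarium.IsFishComponent F v
      ⊎ Aquarium.IsJellyfishComponent F v
proposition4p12 q _ q%8≡5 F = classification
  where open AquariumProperties F q%8≡5
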